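{- Let $k\in\{12,16,18,20,22,26\}$, let $n$ be a positive odd integer and let $b>0$ be an integer. Then $a_k(0,2^bn)\equiv 0\pmod{2^\omega}$.
   Context: Let $q=e^{2\pi iz}$. For $k\in\{12,16,18,20,22,26\}$, $f_{k,0}$ denotes the unique holomorphic modular form of weight $k$ on $\mathrm{SL}_2(\mathbb{Z})$ with $q$-expansion $f_{k,0}=1+\sum_{n\ge2}a_k(0,n)q^n$ (i.e. constant term $1$ and vanishing coefficient of $q$). The constant $\omega$ is $3$ for $k=18,22,26$; $4$ for $k=12,20$; $6$ for $k=16$. -}

module Defs where

open import Data.Nat as ℕ using (ℕ; zero; suc)
open import Data.Nat.Divisibility using (_∣?_)
open import Data.Integer as ℤ using (ℤ; +_; _+_; _-_; _*_; _/ℕ_)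
open import Relation.Nullary using (does)
open import Data.Bool using (if_then_else_)

-- formal power series in q with integer coefficients, as coefficient functions
Series : Set
Series = ℕ → ℤ

sumTo : ℕ → (ℕ → ℤ) → ℤ
sumTo zero    f = f 0
sumTo (suc n) f = sumTo n f + f (suc n)

_⊛_ : Series → Series → Series
(f ⊛ g) n = sumTo n (λ i → f i * g (n ℕ.∸ i))
infixl 7 _⊛_

_⊖_ : Series → Series → Series
(f ⊖ g) n = f n - g n

scale : ℤ → Series → Series
scale c f n = c * f n

one : Series
one zero    = + 1
one (suc _) = + 0

σ : ℕ → ℕ → ℕ
σ r n = go n
  where
  go : ℕ → ℕ
  go zero    = 0
  go (suc d) = (if does (suc d ∣? n) then suc d ℕ.^ r else 0) ℕ.+ go d

E4 : Series
E4 zero    = + 1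
E4 (suc n) = + (240 ℕ.* σ 3 (suc n))

E6 : Series
E6 zero    = + 1
E6 (suc n) = ℤ.- (+ (504 ℕ.* σ 5 (suc n)))

-- Δ = (E4³ - E6²)/1728  (exact division)
Δ : Series
Δ n = ((E4 ⊛ E4 ⊛ E4) ⊖ (E6 ⊛ E6)) n /ℕ 1728

data Weight : Set where
  w12 w16 w18 w20 w22 w26 : Weight

weight : Weight → ℕ
weight w12 = 12
weight w16 = 16
weight w18 = 18
weight w20 = 20
weight w22 = 22
weight w26 = 26

ω : Weight → ℕ
ω w12 = 4
ω w16 = 6
ω w18 = 3
ω w20 = 4
ω w22 = 3
ω w26 = 3

G : Weight → Series
G w12 = E4 ⊛ E4 ⊛ E4
G w16 = E4 ⊛ E4 ⊛ E4 ⊛ E4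
G w18 = E4 ⊛ E4 ⊛ E4 ⊛ E6
G w20 = E4 ⊛ E4 ⊛ E4 ⊛ E4 ⊛ E4
G w22 = E4 ⊛ E4 ⊛ E4 ⊛ E4 ⊛ E6
G w26 = E4 ⊛ E4 ⊛ E4 ⊛ E4 ⊛ E4 ⊛ E6

H : Weight → Series
H w12 = one
H w16 = E4
H w18 = E6
H w20 = E4 ⊛ E4
H w22 = E4 ⊛ E6
H w26 = E4 ⊛ E4 ⊛ E6

-- f_{k,0} = G_k - a_1(G_k) Δ H_k : the unique form in M_k with q-expansion 1 + O(q^2)
f₀ : Weight → Series
f₀ k = G k ⊖ scale (G k 1) (Δ ⊛ H k)

a : Weight → ℕ → ℤ
a k n = f₀ k n

{-# OPTIONS --safe #-}
-- In fact 2^ω divides a_k(0, n) for every n ≥ 1.  Since 16 ∣ 240 and 8 ∣ 504, we have E4 ≡ 1 (mod 16)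
-- and E6 ≡ 1 (mod 8) away from the constant term, and such congruences survive
-- products; this gives G_k ≡ 1 (mod 2^ω) except for k = 16, where
-- E4 = 1 + 16A yields E4⁴ ≡ 1 + 64A (mod 256).  Finally f_{k,0} = G_k − a_1(G_k) Δ H_k,
-- and a_1(G_k) ≡ 0 (mod 2^ω) is itself one of these congruences.
module Submission where

open import Defs
open import Data.Nat using (ℕ; _<_; _^_; _*_)
open import Data.Nat.Divisibility using (_∣_)
open import Data.Integer using (+_)
open import Data.Integer.Divisibility renaming (_∣_ to _∣ℤ_)
open import Relation.Nullary using (¬_)

open import Data.Nat as ℕ using (zero; suc; _≤_)
import Data.Nat.Properties as ℕ
import Data.Nat.Divisibility as ℕ
open import Data.Integer as ℤ using (ℤ; 0ℤ; 1ℤ; _+_; _-_)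
import Data.Integer.Properties as ℤ
open import Data.Integer.Divisibility.Signed as Signed
  using (∣-trans; ∣m∣n⇒∣m+n; ∣m∣n⇒∣m-n; ∣m⇒∣m*n; ∣n⇒∣m*n; ∣ᵤ⇒∣; ∣⇒∣ᵤ)
open import Data.Integer.Tactic.RingSolver using (solve-∀)
open import Function using (_∘_)
open import Relation.Binary.PropositionalEquality
  using (_≡_; refl; sym; trans; cong; cong₂; subst; module ≡-Reasoning)

infix 4 _∣ᶻ_
_∣ᶻ_ : ℤ → ℤ → Set
_∣ᶻ_ = Signed._∣_

*-pres-∣ᶻ : ∀ {a b x y} → a ∣ᶻ x → b ∣ᶻ y → a ℤ.* b ∣ᶻ x ℤ.* y
*-pres-∣ᶻ {b = b} {x} a∣x b∣y = ∣-trans (Signed.*-monoˡ-∣ b a∣x) (Signed.*-monoʳ-∣ x b∣y)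

n∣ᶻ0 : ∀ d → d ∣ᶻ 0ℤ
n∣ᶻ0 d = Signed.divides 0ℤ refl

infix 4 _∣⁺_
record _∣⁺_ (d : ℤ) (f : Series) : Set where
  constructor ∣⁺-intro
  field ∣⁺-suc : ∀ n → d ∣ᶻ f (suc n)
open _∣⁺_

∣⁺-coeff : ∀ {d f n} → d ∣⁺ f → 0 < n → d ∣ᶻ f n
∣⁺-coeff {n = suc n} d∣⁺f _ = ∣⁺-suc d∣⁺f n

∣⁺-weaken : ∀ {d e f} → d ∣ᶻ e → e ∣⁺ f → d ∣⁺ f
∣⁺-weaken d∣e e∣⁺f = ∣⁺-intro λ n → ∣-trans d∣e (∣⁺-suc e∣⁺f n)

∣⁺-⊖-scale : ∀ {d c f g} → d ∣⁺ f → d ∣ᶻ c → d ∣⁺ (f ⊖ scale c g)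
∣⁺-⊖-scale {g = g} d∣⁺f d∣c =
  ∣⁺-intro λ n → ∣m∣n⇒∣m-n (∣⁺-suc d∣⁺f n) (∣m⇒∣m*n (g (suc n)) d∣c)

sumTo-head : ∀ n h → sumTo (suc n) h ≡ h 0 + sumTo n (h ∘ suc)
sumTo-head zero    h = refl
sumTo-head (suc n) h =
  trans (cong (_+ h (suc (suc n))) (sumTo-head n h))
        (ℤ.+-assoc (h 0) (sumTo n (h ∘ suc)) (h (suc (suc n))))

∣-sumTo : ∀ {d} n h → (∀ i → i ≤ n → d ∣ᶻ h i) → d ∣ᶻ sumTo n h
∣-sumTo zero    h d∣h = d∣h 0 ℕ.z≤n
∣-sumTo (suc n) h d∣h =
  ∣m∣n⇒∣m+n (∣-sumTo n h (λ i i≤n → d∣h i (ℕ.m≤n⇒m≤1+n i≤n))) (d∣h (suc n) ℕ.≤-refl)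

∣⁺-⊛ : ∀ {d f g} → d ∣⁺ f → d ∣⁺ g → d ∣⁺ (f ⊛ g)
∣⁺-⊛ {d} {f} {g} d∣⁺f d∣⁺g = ∣⁺-intro λ n → ∣-sumTo (suc n) _ (λ i _ → d∣term n i)
  where
  d∣term : ∀ n i → d ∣ᶻ f i ℤ.* g (suc n ℕ.∸ i)
  d∣term n zero    = ∣n⇒∣m*n (f 0) (∣⁺-suc d∣⁺g n)
  d∣term n (suc i) = ∣m⇒∣m*n _ (∣⁺-suc d∣⁺f i)

-- If f ≡ 1 (mod d) and g ≡ 1 (mod e), then fg ≡ f + g − 1 (mod de): every term of
-- the Cauchy sum other than the two end terms is a product of a multiple of d
-- and a multiple of e.
⊛-≡-+ : ∀ {d e f g} → f 0 ≡ 1ℤ → g 0 ≡ 1ℤ → d ∣⁺ f → e ∣⁺ g →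
  ∀ n → d ℤ.* e ∣ᶻ (f ⊛ g) (suc n) - (f (suc n) + g (suc n))
⊛-≡-+ {d} {e} {f} {g} f0≡1 g0≡1 d∣⁺f e∣⁺g n =
  subst (d ℤ.* e ∣ᶻ_) (sym difference) (interior n)
  where
  interior : ∀ n → d ℤ.* e ∣ᶻ sumTo n (λ i → f (suc i) ℤ.* g (n ℕ.∸ i)) - f (suc n)
  interior zero =
    subst (d ℤ.* e ∣ᶻ_)
      (sym (trans (cong (λ c → f 1 ℤ.* c - f 1) g0≡1)
                  (trans (cong (_- f 1) (ℤ.*-identityʳ (f 1))) (ℤ.+-inverseʳ (f 1)))))
      (n∣ᶻ0 _)
  interior (suc n) =
    subst (d ℤ.* e ∣ᶻ_)
      (sym (trans (cong (λ c → S + f (suc (suc n)) ℤ.* c - f (suc (suc n)))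
                        (trans (cong g (ℕ.n∸n≡0 n)) g0≡1))
                  (cancel S (f (suc (suc n))))))
      (∣-sumTo n _ de∣term)
    where
    S : ℤ
    S = sumTo n (λ i → f (suc i) ℤ.* g (suc n ℕ.∸ i))
    cancel : ∀ s x → s + x ℤ.* 1ℤ - x ≡ s
    cancel = solve-∀
    de∣term : ∀ i → i ≤ n → d ℤ.* e ∣ᶻ f (suc i) ℤ.* g (suc n ℕ.∸ i)
    de∣term i i≤n rewrite ℕ.+-∸-assoc 1 i≤n =
      *-pres-∣ᶻ (∣⁺-suc d∣⁺f i) (∣⁺-suc e∣⁺g (n ℕ.∸ i))
  difference : (f ⊛ g) (suc n) - (f (suc n) + g (suc n))
             ≡ sumTo n (λ i → f (suc i) ℤ.* g (n ℕ.∸ i)) - f (suc n)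
  difference = begin
    (f ⊛ g) (suc n) - (f (suc n) + g (suc n))
      ≡⟨ cong (_- (f (suc n) + g (suc n))) (sumTo-head n _) ⟩
    f 0 ℤ.* g (suc n) + T - (f (suc n) + g (suc n))
      ≡⟨ cong (λ c → c ℤ.* g (suc n) + T - (f (suc n) + g (suc n))) f0≡1 ⟩
    1ℤ ℤ.* g (suc n) + T - (f (suc n) + g (suc n))
      ≡⟨ rearrange (g (suc n)) T (f (suc n)) ⟩
    T - f (suc n) ∎
    where
    open ≡-Reasoning
    T : ℤ
    T = sumTo n (λ i → f (suc i) ℤ.* g (n ℕ.∸ i))
    rearrange : ∀ y t x → 1ℤ ℤ.* y + t - (x + y) ≡ t - x
    rearrange = solve-∀

infixl 8 _^⊛_
_^⊛_ : Series → ℕ → Series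
f ^⊛ zero          = one
f ^⊛ suc zero      = f
f ^⊛ suc (suc n)   = f ^⊛ suc n ⊛ f

^⊛-constant : ∀ {f} → f 0 ≡ 1ℤ → ∀ n → (f ^⊛ n) 0 ≡ 1ℤ
^⊛-constant f0≡1 zero          = refl
^⊛-constant f0≡1 (suc zero)    = f0≡1
^⊛-constant f0≡1 (suc (suc n)) = cong₂ ℤ._*_ (^⊛-constant f0≡1 (suc n)) f0≡1

∣⁺-^⊛ : ∀ {d f} → d ∣⁺ f → ∀ n → d ∣⁺ f ^⊛ n
∣⁺-^⊛ {d} d∣⁺f zero          = ∣⁺-intro λ _ → n∣ᶻ0 d
∣⁺-^⊛     d∣⁺f (suc zero)      = d∣⁺f
∣⁺-^⊛     d∣⁺f (suc (suc n))   = ∣⁺-⊛ (∣⁺-^⊛ d∣⁺f (suc n)) d∣⁺f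

^⊛-≡-* : ∀ {d f} → f 0 ≡ 1ℤ → d ∣⁺ f →
  ∀ n m → d ℤ.* d ∣ᶻ (f ^⊛ suc n) (suc m) - + suc n ℤ.* f (suc m)
^⊛-≡-* {d} {f} f0≡1 d∣⁺f zero m =
  subst (d ℤ.* d ∣ᶻ_)
    (sym (trans (cong (f (suc m) -_) (ℤ.*-identityˡ (f (suc m))))
                (ℤ.+-inverseʳ (f (suc m)))))
    (n∣ᶻ0 _)
^⊛-≡-* {d} {f} f0≡1 d∣⁺f (suc n) m =
  subst (d ℤ.* d ∣ᶻ_) (sym combine)
    (∣m∣n⇒∣m+n (⊛-≡-+ (^⊛-constant f0≡1 (suc n)) f0≡1 (∣⁺-^⊛ d∣⁺f (suc n)) d∣⁺f m)
                (^⊛-≡-* f0≡1 d∣⁺f n m))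
  where
  F : Series
  F = f ^⊛ suc n
  combine : (F ⊛ f) (suc m) - + suc (suc n) ℤ.* f (suc m)
          ≡ ((F ⊛ f) (suc m) - (F (suc m) + f (suc m))) + (F (suc m) - + suc n ℤ.* f (suc m))
  combine = begin
    (F ⊛ f) (suc m) - + suc (suc n) ℤ.* f (suc m)
      ≡⟨ cong (λ c → (F ⊛ f) (suc m) - c ℤ.* f (suc m)) (ℤ.pos-+ 1 (suc n)) ⟩
    (F ⊛ f) (suc m) - (1ℤ + + suc n) ℤ.* f (suc m)
      ≡⟨ regroup ((F ⊛ f) (suc m)) (F (suc m)) (f (suc m)) (+ suc n) ⟩
    ((F ⊛ f) (suc m) - (F (suc m) + f (suc m))) + (F (suc m) - + suc n ℤ.* f (suc m)) ∎
    where
    open ≡-Reasoning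
    regroup : ∀ p x y k → p - (1ℤ + k) ℤ.* y ≡ (p - (x + y)) + (x - k ℤ.* y)
    regroup = solve-∀

E4-∣⁺ : + 16 ∣⁺ E4
E4-∣⁺ = ∣⁺-intro λ n → ∣ᵤ⇒∣ (ℕ.∣m⇒∣m*n (σ 3 (suc n)) (ℕ.divides 15 refl))

E6-∣⁺ : + 8 ∣⁺ E6
E6-∣⁺ = ∣⁺-intro λ n → Signed.∣m⇒∣-m (∣ᵤ⇒∣ (ℕ.∣m⇒∣m*n (σ 5 (suc n)) (ℕ.divides 63 refl)))

E4-∣⁺-8 : + 8 ∣⁺ E4
E4-∣⁺-8 = ∣⁺-weaken (∣ᵤ⇒∣ (ℕ.divides 2 refl)) E4-∣⁺

E4⁴-∣⁺ : + 64 ∣⁺ E4 ^⊛ 4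
E4⁴-∣⁺ = ∣⁺-intro λ m →
  Signed.∣m+n∣n⇒∣m (∣-trans (∣ᵤ⇒∣ (ℕ.divides 4 refl)) (^⊛-≡-* refl E4-∣⁺ 3 m))
                   (Signed.∣m⇒∣-m (Signed.*-monoʳ-∣ (+ 4) (∣⁺-suc E4-∣⁺ m)))

G-∣⁺ : ∀ k → + (2 ^ ω k) ∣⁺ G k
G-∣⁺ w12 = ∣⁺-^⊛ E4-∣⁺ 3
G-∣⁺ w16 = E4⁴-∣⁺
G-∣⁺ w18 = ∣⁺-⊛ (∣⁺-^⊛ E4-∣⁺-8 3) E6-∣⁺
G-∣⁺ w20 = ∣⁺-^⊛ E4-∣⁺ 5
G-∣⁺ w22 = ∣⁺-⊛ (∣⁺-^⊛ E4-∣⁺-8 4) E6-∣⁺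
G-∣⁺ w26 = ∣⁺-⊛ (∣⁺-^⊛ E4-∣⁺-8 5) E6-∣⁺

f₀-∣⁺ : ∀ k → + (2 ^ ω k) ∣⁺ f₀ k
f₀-∣⁺ k = ∣⁺-⊖-scale (G-∣⁺ k) (∣⁺-suc (G-∣⁺ k) 0)

lemma6p4 : (k : Weight) (n b : ℕ) → 0 < n → ¬ (2 ∣ n) → 0 < b →
    (+ (2 ^ ω k)) ∣ℤ a k (2 ^ b * n)
lemma6p4 k n b n>0 _ _ = ∣⇒∣ᵤ (∣⁺-coeff (f₀-∣⁺ k) (ℕ.*-mono-< (ℕ.m^n>0 2 b) n>0))
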